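{- Let $k\ge 2$, let $G=(V,W,E,\le)$ be an ordered bipartite graph in which every vertex of $V$ has degree $3$ and which is $2k$-meager, let $X=\{\mathfrak u_1,\dots,\mathfrak u_\ell\}\subseteq W$ be $6k$-scattered, let $Y\subseteq W$ satisfy $X\cap\mathrm{cl}(Y)=\emptyset$ and $|Y|<k$, and let $\phi$ be an automorphism of $\mathfrak M(G)^{\mathrm{feet}}[Y]$. Then for all tuples $\bar u,\bar u'\in F(\mathfrak u_1)\times\cdots\times F(\mathfrak u_\ell)$ there exists an automorphism $\psi$ of $\mathfrak M(G)^{\mathrm{feet}}[X\cup Y]$ extending $\phi$ with $\psi(\bar u)=\bar u'$.
   Context: Multipede $\mathfrak M(G)$: for each $\mathfrak u\in W$ (a segment) there are two vertices $u_0,u_1$, the feet of $\mathfrak u$, and $F(\mathfrak u)=\{u_0,u_1\}$; for each $\mathfrak v\in V$ with neighbors $\mathfrak u^1<\mathfrak u^2<\mathfrak u^3$ (ordered by $\le$), a ternary relation $R$ contains all triples $(u^1_{i_1},u^2_{i_2},u^3_{i_3})$ with $i_1+i_2+i_3=0$ in $\mathbb F_2$; feet are colored according to their segment. For $Z\subseteq W$, $\mathfrak M(G)^{\mathrm{feet}}[Z]$ is the substructure induced by all feet of segments in $Z$. $G$ is $k$-meager if every $Z\subseteq W$ with $|Z|\le 2k$ satisfies $|\{\mathfrak v\in V:N_G(\mathfrak v)\subseteq Z\}|\le 2|Z|$. $X\subseteq W$ is $k$-scattered if any two distinct vertices of $X$ have distance at least $2k$ in $G$. For $Z\subseteq W$,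 $\mathrm{Att}(Z)=Z\cup\bigcup\{N_G(\mathfrak v):\mathfrak v\in V,\ |N_G(\mathfrak v)\setminus Z|\le1\}$; $Z$ is closed if $Z=\mathrm{Att}(Z)$; $\mathrm{cl}(Z)$ is the minimal closed superset of $Z$. -}

module Defs where

open import Data.Nat using (ℕ; zero; suc; _≤_; _<_; _*_; _≤?_)
open import Data.Fin using (Fin) renaming (_<_ to _<ᶠ_)
open import Data.Fin.Subset using (Subset; _∈_; _⊆_; _∪_; _∩_; _─_; ⋃; ∣_∣; Empty)
open import Data.Fin.Subset.Properties using (_⊆?_)
open import Data.Vec using (tabulate)
open import Data.List using (List; allFin; filter; map)
open import Data.Bool using (Bool; false; _xor_)
open import Data.Sum using (_⊎_; inj₁; inj₂)
open import Data.Product using (Σ; Σ-syntax; ∃; ∃-syntax; _×_; _,_; proj₁; proj₂)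
open import Relation.Nullary using (¬_; does)
open import Relation.Binary.PropositionalEquality using (_≡_; _≢_)
open import Function.Bundles using (_↔_; Inverse; _⇔_)

-- The edge relation is given by the neighbourhood N v ⊆ W of each v ∈ V;
-- the linear order ≤ on W is the natural order of Fin nW.
record BipGraph : Set where
  field
    nV nW : ℕ
    N : Fin nV → Subset nW

module _ (G : BipGraph) where
  open BipGraph G

  Degree3 : Set
  Degree3 = ∀ v → ∣ N v ∣ ≡ 3

  inside : Subset nW → ℕ
  inside Z = ∣ tabulate (λ v → does (N v ⊆? Z)) ∣

  Meager : ℕ → Set
  Meager k = ∀ (Z : Subset nW) → ∣ Z ∣ ≤ 2 * k → inside Z ≤ 2 * ∣ Z ∣

  Vertex : Set
  Vertex = Fin nV ⊎ Fin nW

  data Adj : Vertex → Vertex → Set where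
    vw : ∀ v w → w ∈ N v → Adj (inj₁ v) (inj₂ w)
    wv : ∀ v w → w ∈ N v → Adj (inj₂ w) (inj₁ v)

  data Walk : Vertex → Vertex → ℕ → Set where
    nil  : ∀ x → Walk x x zero
    cons : ∀ {x y z n} → Adj x y → Walk y z n → Walk x z (suc n)

  -- dist(x,y) ≥ d  (possibly infinite distance)
  DistAtLeast : Vertex → Vertex → ℕ → Set
  DistAtLeast x y d = ∀ n → n < d → ¬ Walk x y n

  Scattered : ℕ → Subset nW → Set
  Scattered k X = ∀ u u' → u ∈ X → u' ∈ X → u ≢ u' →
                  DistAtLeast (inj₂ u) (inj₂ u') (2 * k)

  Att : Subset nW → Subset nW
  Att Z = Z ∪ ⋃ (map N (filter (λ v → ∣ N v ─ Z ∣ ≤? 1) (allFin nV)))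

  Closed : Subset nW → Set
  Closed Z = Att Z ≡ Z

  IsClosure : Subset nW → Subset nW → Set
  IsClosure Z C = Z ⊆ C × Closed C × (∀ C' → Z ⊆ C' → Closed C' → C ⊆ C')

  -- feet: foot (u , i) is u_i; F₂ is represented by Bool with xor
  Foot : Set
  Foot = Fin nW × Bool

  data R : Foot → Foot → Foot → Set where
    rel : ∀ v a b c i j k → a <ᶠ b → b <ᶠ c → a ∈ N v → b ∈ N v → c ∈ N v →
          (i xor j) xor k ≡ false → R (a , i) (b , j) (c , k)

  FeetOf : Subset nW → Set
  FeetOf Z = Σ[ x ∈ Foot ] (proj₁ x ∈ Z)

  -- automorphisms of M(G)^feet[Z] (colours = segments, and R, preserved)
  record Aut (Z : Subset nW) : Set where
    field
      perm   : FeetOf Z ↔ FeetOf Z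
    open Inverse perm public using (to)
    field
      colour : ∀ x → proj₁ (proj₁ (to x)) ≡ proj₁ (proj₁ x)
      relR   : ∀ x y z → R (proj₁ x) (proj₁ y) (proj₁ z) ⇔
                         R (proj₁ (to x)) (proj₁ (to y)) (proj₁ (to z))

  Extends : ∀ {Y Z} → Y ⊆ Z → Aut Z → Aut Y → Set
  Extends {Y} Y⊆Z ψ φ = ∀ (x : FeetOf Y) →
    proj₁ (Aut.to ψ (proj₁ x , Y⊆Z (proj₂ x))) ≡ proj₁ (Aut.to φ x)

module Submission where

open import Defs
open import Data.Nat using (ℕ; _≤_; _<_; _*_)
open import Data.Fin.Subset using (Subset; _∈_; _∪_; _∩_; ∣_∣; Empty)
open import Data.Fin.Subset.Properties using (p⊆p∪q; q⊆p∪q)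
open import Data.Bool using (Bool)
open import Data.Product using (Σ; ∃; _×_; _,_; proj₁)
open import Relation.Binary.PropositionalEquality using (_≡_)

open import Algebra.Bundles using (CommutativeRing)
import Algebra.Properties.CommutativeSemigroup as CommutativeSemigroupProperties
open import Data.Bool using (true; false; _xor_)
open import Data.Bool.Properties
  using (xor-∧-commutativeRing; xor-assoc; xor-same; xor-identityʳ; ¬-not)
open import Data.Empty using (⊥; ⊥-elim)
open import Data.Fin using (Fin) renaming (_<_ to _<ᶠ_)
open import Data.Fin.Properties using (<⇒≢; <-trans)
open import Data.Fin.Subset using (inside; _∉_; _⊆_; _─_; _-_; ⋃)
open import Data.Fin.Subset.Properties
  using (_∈?_; x∈p∩q⁺; x∈p∪q⁻; p⊆q⇒∣p∣≤∣q∣; p─q⊆p; x∈p∧x≢y⇒x∈p-y; x∈p⇒∣p-x∣<∣p∣)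
open import Data.List using (List; allFin; filter) renaming (_∷_ to _∷ₗ_)
open import Data.List.Membership.Propositional using () renaming (_∈_ to _∈ₗ_)
open import Data.List.Membership.Propositional.Properties using (∈-map⁺; ∈-filter⁺; ∈-allFin)
import Data.List.Relation.Unary.Any as ListAny
open import Data.Nat using (_+_; s≤s; _≤?_)
open import Data.Nat.Properties
  using (≤-pred; ≤-trans; m≤n*m; n≤1+n; +-monoʳ-≤; *-monoʳ-≤; module ≤-Reasoning)
open import Data.Product using (proj₂)
open import Data.Sum using (inj₁; inj₂)
open import Data.Vec using (_∷_; here; there)
open import Function using (_∘_)
open import Function.Bundles using (Injection; Equivalence; mk↔ₛ′; mk⇔)
open import Function.Properties.Inverse using (Inverse⇒Injection)
open import Relation.Binary.PropositionalEquality using (refl; sym; trans; cong; cong₂; subst; _≢_; module ≡-Reasoning)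
open import Relation.Nullary using (yes; no)

-- An automorphism of M(G)^feet[Z] fixes every segment, so it is a flip: it swaps
-- the two feet of the segments u with g(u) = 1 and fixes the others.  A flip
-- preserves R iff g sums to 0 over the three neighbours of every v ∈ V whose
-- neighbourhood lies in Z.  Extend the flip bits of φ by g(u) = ū(u) + ū'(u) on X.
-- A neighbourhood inside X ∪ Y meets X at most once, since two segments with a
-- common neighbour are at distance 2; and if it met X exactly once, its other two
-- segments would lie in Y ⊆ cl(Y), and closedness would force the third into
-- cl(Y), which is disjoint from X.
-- So it lies in Y, where the bits of φ already sum to 0.

∈-irrelevant : ∀ {n} {p : Subset n} {x} (a b : x ∈ p) → a ≡ b
∈-irrelevant here      here      = refl
∈-irrelevant (there a) (there b) = cong there (∈-irrelevant a b)

x∈p─q⇒x∉q : ∀ {n} (p q : Subset n) {x} → x ∈ p ─ q → x ∉ q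
x∈p─q⇒x∉q (_ ∷ p) (inside ∷ q) ()          here
x∈p─q⇒x∉q (_ ∷ p) (_ ∷ q)      (there x∈) (there x∈q) = x∈p─q⇒x∉q p q x∈ x∈q

∣p─q∣≤1 : ∀ {n} (p q : Subset n) {y z} → ∣ p ∣ ≡ 3 →
          y ∈ p → z ∈ p → y ≢ z → y ∈ q → z ∈ q → ∣ p ─ q ∣ ≤ 1
∣p─q∣≤1 p q {y} {z} ∣p∣≡3 y∈p z∈p y≢z y∈q z∈q = ≤-pred (≤-pred (begin
  2 + ∣ p ─ q ∣      ≤⟨ +-monoʳ-≤ 2 (p⊆q⇒∣p∣≤∣q∣ p─q⊆p-y-z) ⟩
  2 + ∣ p - y - z ∣  ≤⟨ s≤s (x∈p⇒∣p-x∣<∣p∣ z∈p-y) ⟩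
  1 + ∣ p - y ∣      ≤⟨ x∈p⇒∣p-x∣<∣p∣ y∈p ⟩
  ∣ p ∣              ≡⟨ ∣p∣≡3 ⟩
  3                  ∎))
  where
  open ≤-Reasoning
  z∈p-y : z ∈ p - y
  z∈p-y = x∈p∧x≢y⇒x∈p-y z∈p (y≢z ∘ sym)
  p─q⊆p-y-z : p ─ q ⊆ p - y - z
  p─q⊆p-y-z x∈ = x∈p∧x≢y⇒x∈p-y (x∈p∧x≢y⇒x∈p-y (p─q⊆p p q x∈) (λ { refl → x∈p─q⇒x∉q p q x∈ y∈q }))
                                                 (λ { refl → x∈p─q⇒x∉q p q x∈ z∈q })

⊆-⋃ : ∀ {n} {p : Subset n} {ps : List (Subset n)} → p ∈ₗ ps → p ⊆ ⋃ ps
⊆-⋃ {ps = q ∷ₗ ps} (ListAny.here refl) x∈p = p⊆p∪q (⋃ ps) x∈p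
⊆-⋃ {ps = q ∷ₗ ps} (ListAny.there p∈ps) x∈p = q⊆p∪q q (⋃ ps) (⊆-⋃ p∈ps x∈p)

xor-cancelʳ : ∀ x y → (x xor y) xor y ≡ x
xor-cancelʳ x y = begin
  (x xor y) xor y  ≡⟨ xor-assoc x y y ⟩
  x xor (y xor y)  ≡⟨ cong (x xor_) (xor-same y) ⟩
  x xor false      ≡⟨ xor-identityʳ x ⟩
  x                ∎
  where open ≡-Reasoning

xor-cancelˡ : ∀ x y → x xor (x xor y) ≡ y
xor-cancelˡ x y = begin
  x xor (x xor y)  ≡⟨ xor-assoc x x y ⟨
  (x xor x) xor y  ≡⟨ cong (_xor y) (xor-same x) ⟩
  y                ∎
  where open ≡-Reasoning

open CommutativeSemigroupProperties (CommutativeRing.+-commutativeSemigroup xor-∧-commutativeRing)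
  using (interchange)

xor-interchange₃ : ∀ i j k x y z →
  ((i xor x) xor (j xor y)) xor (k xor z) ≡ ((i xor j) xor k) xor ((x xor y) xor z)
xor-interchange₃ i j k x y z = begin
  ((i xor x) xor (j xor y)) xor (k xor z)  ≡⟨ cong (_xor (k xor z)) (interchange i x j y) ⟩
  ((i xor j) xor (x xor y)) xor (k xor z)  ≡⟨ interchange (i xor j) (x xor y) k z ⟩
  ((i xor j) xor k) xor ((x xor y) xor z)  ∎
  where open ≡-Reasoning

module _ (G : BipGraph) where
  open BipGraph G

  BalancedOn : Subset nW → (Fin nW → Bool) → Set
  BalancedOn Z g = ∀ {v a b c} → a <ᶠ b → b <ᶠ c → a ∈ N v → b ∈ N v → c ∈ N v →
                   a ∈ Z → b ∈ Z → c ∈ Z → (g a xor g b) xor g c ≡ false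

  R-even : ∀ {a i b j c k} → R G (a , i) (b , j) (c , k) → (i xor j) xor k ≡ false
  R-even (rel _ _ _ _ _ _ _ _ _ _ _ _ even) = even

  R-resp : ∀ {x x′ y y′ z z′} → x ≡ x′ → y ≡ y′ → z ≡ z′ → R G x y z → R G x′ y′ z′
  R-resp refl refl refl r = r

  feet-≡ : ∀ {Z} {x y : FeetOf G Z} → proj₁ x ≡ proj₁ y → x ≡ y
  feet-≡ {x = a , a∈Z} {y = .a , a∈Z′} refl = cong (a ,_) (∈-irrelevant a∈Z a∈Z′)

  flipFoot : (Fin nW → Bool) → ∀ {Z} → FeetOf G Z → FeetOf G Z
  flipFoot g ((a , i) , a∈Z) = (a , i xor g a) , a∈Z

  flipFoot-involutive : ∀ g {Z} (x : FeetOf G Z) → flipFoot g (flipFoot g x) ≡ x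
  flipFoot-involutive g ((a , i) , a∈Z) = cong (λ j → (a , j) , a∈Z) (xor-cancelʳ i (g a))

  flipFoot-preserves-R : ∀ {Z g} → BalancedOn Z g → (x y z : FeetOf G Z) →
    R G (proj₁ x) (proj₁ y) (proj₁ z) →
    R G (proj₁ (flipFoot g x)) (proj₁ (flipFoot g y)) (proj₁ (flipFoot g z))
  flipFoot-preserves-R {g = g} balanced ((a , i) , a∈Z) ((b , j) , b∈Z) ((c , k) , c∈Z)
    (rel v _ _ _ _ _ _ a<b b<c a∈ b∈ c∈ even) =
    rel v a b c _ _ _ a<b b<c a∈ b∈ c∈ (begin
      ((i xor g a) xor (j xor g b)) xor (k xor g c)  ≡⟨ xor-interchange₃ i j k (g a) (g b) (g c) ⟩
      ((i xor j) xor k) xor ((g a xor g b) xor g c)  ≡⟨ cong₂ _xor_ even (balanced a<b b<c a∈ b∈ c∈ a∈Z b∈Z c∈Z) ⟩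
      false                                          ∎)
    where open ≡-Reasoning

  flip : ∀ {Z} g → BalancedOn Z g → Aut G Z
  flip g balanced = record
    { perm   = mk↔ₛ′ (flipFoot g) (flipFoot g) (flipFoot-involutive g) (flipFoot-involutive g)
    ; colour = λ _ → refl
    ; relR   = λ x y z → mk⇔ (flipFoot-preserves-R {g = g} balanced x y z) (unflip x y z)
    }
    where
    unflip : ∀ x y z → R G (proj₁ (flipFoot g x)) (proj₁ (flipFoot g y)) (proj₁ (flipFoot g z)) →
             R G (proj₁ x) (proj₁ y) (proj₁ z)
    unflip x y z r = R-resp (cong proj₁ (flipFoot-involutive g x)) (cong proj₁ (flipFoot-involutive g y))
      (cong proj₁ (flipFoot-involutive g z))
      (flipFoot-preserves-R {g = g} balanced (flipFoot g x) (flipFoot g y) (flipFoot g z) r)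

  flipBit : ∀ {Z} → Aut G Z → (a : Fin nW) → a ∈ Z → Bool
  flipBit φ a a∈Z = proj₂ (proj₁ (Aut.to φ ((a , false) , a∈Z)))

  Aut-flips : ∀ {Z} (φ : Aut G Z) a i (a∈Z : a ∈ Z) →
              proj₁ (Aut.to φ ((a , i) , a∈Z)) ≡ (a , i xor flipBit φ a a∈Z)
  Aut-flips φ a false a∈Z = cong (_, flipBit φ a a∈Z) (Aut.colour φ ((a , false) , a∈Z))
  Aut-flips φ a true  a∈Z = cong₂ _,_ (Aut.colour φ foot₁) (¬-not images-differ)
    where
    foot₀ foot₁ : FeetOf G _
    foot₀ = (a , false) , a∈Z
    foot₁ = (a , true) , a∈Z
    images-differ : proj₂ (proj₁ (Aut.to φ foot₁)) ≢ flipBit φ a a∈Z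
    images-differ same-bit
      with Injection.injective (Inverse⇒Injection (Aut.perm φ))
             (feet-≡ (cong₂ _,_ (trans (Aut.colour φ foot₁) (sym (Aut.colour φ foot₀))) same-bit))
    ... | ()

  flipBit-balanced : ∀ {Z} (φ : Aut G Z) {v a b c} → a <ᶠ b → b <ᶠ c → a ∈ N v → b ∈ N v → c ∈ N v →
    (a∈Z : a ∈ Z) (b∈Z : b ∈ Z) (c∈Z : c ∈ Z) →
    (flipBit φ a a∈Z xor flipBit φ b b∈Z) xor flipBit φ c c∈Z ≡ false
  flipBit-balanced φ {v} {a} {b} {c} a<b b<c a∈ b∈ c∈ a∈Z b∈Z c∈Z =
    R-even (Equivalence.to (Aut.relR φ ((a , false) , a∈Z) ((b , false) , b∈Z) ((c , false) , c∈Z))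
                           (rel v a b c false false false a<b b<c a∈ b∈ c∈ refl))

  scattered⇒no-common-neighbour : ∀ {d X} → 2 ≤ d → Scattered G d X →
    ∀ {v a b} → a ∈ N v → b ∈ N v → a ≢ b → a ∈ X → b ∈ X → ⊥
  scattered⇒no-common-neighbour 2≤d scattered {v} {a} {b} a∈ b∈ a≢b a∈X b∈X =
    scattered a b a∈X b∈X a≢b 2 (≤-trans (n≤1+n 3) (*-monoʳ-≤ 2 2≤d))
              (cons (wv v a a∈) (cons (vw v b b∈) (nil _)))

  closed⇒third-neighbour∈ : Degree3 G → ∀ {C} → Closed G C →
    ∀ {v a b c} → a ∈ N v → b ∈ N v → c ∈ N v → b ≢ c → b ∈ C → c ∈ C → a ∈ C
  closed⇒third-neighbour∈ degree3 {C} closed {v} {a} a∈ b∈ c∈ b≢c b∈C c∈C =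
    subst (a ∈_) closed (q⊆p∪q C _ (⊆-⋃ (∈-map⁺ N v∈attaching) a∈))
    where
    v∈attaching : v ∈ₗ filter (λ w → ∣ N w ─ C ∣ ≤? 1) (allFin nV)
    v∈attaching = ∈-filter⁺ (λ w → ∣ N w ─ C ∣ ≤? 1) (∈-allFin v)
                            (∣p─q∣≤1 (N v) C (degree3 v) b∈ c∈ b≢c b∈C c∈C)

  neighbour∈Y : Degree3 G → ∀ {d X Y C} → 2 ≤ d → Scattered G d X →
    Y ⊆ C → Closed G C → Empty (X ∩ C) →
    ∀ {v a b c} → a ∈ N v → b ∈ N v → c ∈ N v → a ≢ b → a ≢ c → b ≢ c →
    a ∈ X ∪ Y → b ∈ X ∪ Y → c ∈ X ∪ Y → a ∈ Y
  neighbour∈Y degree3 {X = X} {Y} {C} 2≤d scattered Y⊆C closed X∩C≡∅ {v} {a}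
    a∈ b∈ c∈ a≢b a≢c b≢c a∈X∪Y b∈X∪Y c∈X∪Y with x∈p∪q⁻ X Y a∈X∪Y
  ... | inj₂ a∈Y = a∈Y
  ... | inj₁ a∈X = ⊥-elim (X∩C≡∅ (a , x∈p∩q⁺ (a∈X , a∈C)))
    where
    other∈Y : ∀ {w} → w ∈ N v → a ≢ w → w ∈ X ∪ Y → w ∈ Y
    other∈Y w∈ a≢w w∈X∪Y with x∈p∪q⁻ X Y w∈X∪Y
    ... | inj₁ w∈X = ⊥-elim (scattered⇒no-common-neighbour 2≤d scattered a∈ w∈ a≢w a∈X w∈X)
    ... | inj₂ w∈Y = w∈Y
    a∈C : a ∈ C
    a∈C = closed⇒third-neighbour∈ degree3 closed a∈ b∈ c∈ b≢c
            (Y⊆C (other∈Y b∈ a≢b b∈X∪Y)) (Y⊆C (other∈Y c∈ a≢c c∈X∪Y))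

module Extension (G : BipGraph) (degree3 : Degree3 G) {d : ℕ} (2≤d : 2 ≤ d)
  {X Y C : Subset (BipGraph.nW G)} (scattered : Scattered G d X)
  (Y⊆C : Y ⊆ C) (closed : Closed G C) (X∩C≡∅ : Empty (X ∩ C))
  (φ : Aut G Y) (ū ū′ : ∀ u → u ∈ X → Bool) where
  open BipGraph G

  bit : Fin nW → Bool
  bit a with a ∈? Y
  ... | yes a∈Y = flipBit G φ a a∈Y
  ... | no _ with a ∈? X
  ...   | yes a∈X = ū a a∈X xor ū′ a a∈X
  ...   | no _    = false

  bit-on-Y : ∀ a (a∈Y : a ∈ Y) → bit a ≡ flipBit G φ a a∈Y
  bit-on-Y a a∈Y with a ∈? Y
  ... | yes a∈Y′ = cong (flipBit G φ a) (∈-irrelevant a∈Y′ a∈Y)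
  ... | no a∉Y   = ⊥-elim (a∉Y a∈Y)

  bit-on-X : ∀ a (a∈X : a ∈ X) → bit a ≡ ū a a∈X xor ū′ a a∈X
  bit-on-X a a∈X with a ∈? Y
  ... | yes a∈Y = ⊥-elim (X∩C≡∅ (a , x∈p∩q⁺ (a∈X , Y⊆C a∈Y)))
  ... | no _ with a ∈? X
  ...   | yes a∈X′ = cong (λ a∈X″ → ū a a∈X″ xor ū′ a a∈X″) (∈-irrelevant a∈X′ a∈X)
  ...   | no a∉X   = ⊥-elim (a∉X a∈X)

  bit-balanced : BalancedOn G (X ∪ Y) bit
  bit-balanced {a = a} {b} {c} a<b b<c a∈ b∈ c∈ a∈X∪Y b∈X∪Y c∈X∪Y =
    trans (cong₂ _xor_ (cong₂ _xor_ (bit-on-Y a a∈Y) (bit-on-Y b b∈Y)) (bit-on-Y c c∈Y))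
          (flipBit-balanced G φ a<b b<c a∈ b∈ c∈ a∈Y b∈Y c∈Y)
    where
    a≢b : a ≢ b
    a≢b = <⇒≢ a<b
    a≢c : a ≢ c
    a≢c = <⇒≢ (<-trans a<b b<c)
    b≢c : b ≢ c
    b≢c = <⇒≢ b<c
    in-Y : ∀ {v x y z} → x ∈ N v → y ∈ N v → z ∈ N v → x ≢ y → x ≢ z → y ≢ z →
           x ∈ X ∪ Y → y ∈ X ∪ Y → z ∈ X ∪ Y → x ∈ Y
    in-Y = neighbour∈Y G degree3 2≤d scattered Y⊆C closed X∩C≡∅
    a∈Y : a ∈ Y
    a∈Y = in-Y a∈ b∈ c∈ a≢b a≢c b≢c a∈X∪Y b∈X∪Y c∈X∪Y
    b∈Y : b ∈ Y
    b∈Y = in-Y b∈ a∈ c∈ (a≢b ∘ sym) b≢c a≢c b∈X∪Y a∈X∪Y c∈X∪Y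
    c∈Y : c ∈ Y
    c∈Y = in-Y c∈ a∈ b∈ (a≢c ∘ sym) (b≢c ∘ sym) a≢b c∈X∪Y a∈X∪Y b∈X∪Y

  ψ : Aut G (X ∪ Y)
  ψ = flip G bit bit-balanced

  ψ-extends-φ : Extends G (q⊆p∪q X Y) ψ φ
  ψ-extends-φ ((a , i) , a∈Y) =
    trans (cong (λ β → a , i xor β) (bit-on-Y a a∈Y)) (sym (Aut-flips G φ a i a∈Y))

  ψ-maps-ū-to-ū′ : ∀ u (u∈X : u ∈ X) →
    proj₁ (Aut.to ψ ((u , ū u u∈X) , p⊆p∪q Y u∈X)) ≡ (u , ū′ u u∈X)
  ψ-maps-ū-to-ū′ u u∈X =
    cong (u ,_) (trans (cong (ū u u∈X xor_) (bit-on-X u u∈X)) (xor-cancelˡ (ū u u∈X) (ū′ u u∈X)))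

lemma7p15 : (k : ℕ) → 2 ≤ k → (G : BipGraph) → Degree3 G → Meager G (2 * k) →
    (X : Subset (BipGraph.nW G)) → Scattered G (6 * k) X →
    (Y : Subset (BipGraph.nW G)) →
    (∃ λ C → IsClosure G Y C × Empty (X ∩ C)) → ∣ Y ∣ < k →
    (φ : Aut G Y) →
    (ū ū' : (u : _) → u ∈ X → Bool) →
    Σ (Aut G (X ∪ Y)) λ ψ →
      Extends G (q⊆p∪q X Y) ψ φ ×
      (∀ u (u∈X : u ∈ X) →
        proj₁ (Aut.to ψ ((u , ū u u∈X) , p⊆p∪q Y u∈X)) ≡ (u , ū' u u∈X))
lemma7p15 k 2≤k G degree3 _ X scattered Y (C , (Y⊆C , closed , _) , X∩C≡∅) _ φ ū ū′ =
  ψ , ψ-extends-φ , ψ-maps-ū-to-ū′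
  where
  open Extension G degree3 (≤-trans 2≤k (m≤n*m k 6)) scattered Y⊆C closed X∩C≡∅ φ ū ū′
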